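{- Let $(G,\alpha)$ be an instance of the Minimum Capacity-Preserving Subgraph problem (MCPS) with unit edge capacities, where $G=(V,E)$ is a directed graph whose underlying undirected graph is connected, $n=|V|$ and $m=|E|$. Then every feasible solution of this instance has at most $\frac{m}{n-1}$ times the number of edges of an optimal solution, i.e., it is an $\frac{m}{n-1}$-approximation.
   Context: All graphs are simple and all edge capacities are $1$. For a directed graph $G=(V,E)$ and $s,t\in V$, $\lambda_G(s,t)$ denotes the maximum number of edge-disjoint directed $s$-$t$-paths in $G$ (the maximum $s$-$t$-flow value with unit capacities). MCPS: given a directed graph $G=(V,E)$ and a retention ratio $\alpha\in(0,1)$, find $E'\subseteq E$ of minimum cardinality such that $G'=(V,E')$ satisfies $\lambda_{G'}(s,t)\ge\alpha\cdot\lambda_G(s,t)$ for all $(s,t)\in V^2$. A feasible solution is any $E'\subseteq E$ satisfying this constraint.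
   Formalization: The retention ratio α takes rational values in $(0,1)$. -}

module Defs where

open import Data.Nat using (ℕ; suc; _∸_)
open import Data.Fin using (Fin)
open import Data.Product using (_×_; _,_; Σ; ∃)
open import Data.Sum using (_⊎_)
open import Data.List using (List; []; _∷_; length)
open import Data.List.Membership.Propositional using (_∈_)
open import Data.List.Relation.Unary.All using (All)
open import Data.List.Relation.Unary.Unique.Propositional using (Unique)
open import Data.List.Relation.Binary.Disjoint.Propositional using (Disjoint)
open import Data.Integer using (+_)
open import Data.Rational as ℚ using (ℚ; _/_; 0ℚ; 1ℚ)
open import Relation.Binary.PropositionalEquality using (_≡_; _≢_)
open import Relation.Nullary using (¬_)

Edge : ℕ → Set
Edge n = Fin n × Fin n

-- An edge set is a duplicate-free list of edges (cardinality = length).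
EdgeSet : ℕ → Set
EdgeSet n = List (Edge n)

record SimpleDigraph (n : ℕ) (E : EdgeSet n) : Set where
  field
    noDup   : Unique E
    noLoops : All (λ e → ¬ (Data.Product.proj₁ e ≡ Data.Product.proj₂ e)) E

SubEdgeSet : {n : ℕ} → EdgeSet n → EdgeSet n → Set
SubEdgeSet E' E = Unique E' × All (λ e → e ∈ E) E'

data Walk {n : ℕ} (E : EdgeSet n) : Fin n → Fin n → Set where
  []  : {v : Fin n} → Walk E v v
  _∷_ : {u v w : Fin n} → (u , v) ∈ E → Walk E v w → Walk E u w

walkEdges : {n : ℕ} {E : EdgeSet n} {u w : Fin n} → Walk E u w → List (Edge n)
walkEdges [] = []
walkEdges (_∷_ {u} {v} _ p) = (u , v) ∷ walkEdges p

walkVertices : {n : ℕ} {E : EdgeSet n} {u w : Fin n} → Walk E u w → List (Fin n)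
walkVertices {u = u} [] = u ∷ []
walkVertices {u = u} (_ ∷ p) = u ∷ walkVertices p

Path : {n : ℕ} → EdgeSet n → Fin n → Fin n → Set
Path E s t = Σ (Walk E s t) (λ p → Unique (walkVertices p))

DisjointPaths : {n : ℕ} → EdgeSet n → Fin n → Fin n → ℕ → Set
DisjointPaths E s t k =
  Σ (Fin k → Path E s t) λ P →
    ∀ i j → i ≢ j →
      Disjoint (walkEdges (Data.Product.proj₁ (P i))) (walkEdges (Data.Product.proj₁ (P j)))

IsLambda : {n : ℕ} → EdgeSet n → Fin n → Fin n → ℕ → Set
IsLambda E s t k = DisjointPaths E s t k × ¬ DisjointPaths E s t (suc k)

data UWalk {n : ℕ} (E : EdgeSet n) : Fin n → Fin n → Set where
  []  : {v : Fin n} → UWalk E v v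
  _∷_ : {u v w : Fin n} → ((u , v) ∈ E ⊎ (v , u) ∈ E) → UWalk E v w → UWalk E u w

UnderlyingConnected : {n : ℕ} → EdgeSet n → Set
UnderlyingConnected {n} E = (u v : Fin n) → UWalk E u v

ℕtoℚ : ℕ → ℚ
ℕtoℚ k = + k / 1

Feasible : {n : ℕ} → EdgeSet n → ℚ → EdgeSet n → Set
Feasible {n} E α E' =
  SubEdgeSet E' E ×
  ((s t : Fin n) → s ≢ t → (k k' : ℕ) →
     IsLambda E s t k → IsLambda E' s t k' →
     α ℚ.* ℕtoℚ k ℚ.≤ ℕtoℚ k')

Optimal : {n : ℕ} → EdgeSet n → ℚ → EdgeSet n → Set
Optimal E α F = Feasible E α F × (∀ F' → Feasible E α F' → length F Data.Nat.≤ length F')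

{-# OPTIONS --safe #-}
-- A feasible solution is a subset of E, so it has at most m edges. Conversely, every edge (u , v)
-- of G gives λ_G(u,v) ≥ 1, so α > 0 forces λ_F(u,v) ≥ 1 for any feasible F: F contains a directed
-- u-v walk. Thus F weakly connects the connected graph G and has at least n - 1 edges, which we
-- see by labelling the vertices with their F-components: each edge merges at most two classes.
module Submission where

open import Defs
open import Data.Nat using (ℕ; _*_; _∸_; _≤_)
open import Data.List using (length)
open import Data.Rational using (ℚ; 0ℚ; 1ℚ; _<_)

open import Data.Nat using (zero; suc; _+_; z≤n; s≤s)
open import Data.Nat.Properties
  using (≤-refl; ≤-trans; ≤-reflexive; n≤1+n; +-identityʳ; +-suc; +-monoˡ-≤; ∸-monoˡ-≤; *-mono-≤; <-irrefl; module ≤-Reasoning)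
open import Data.Fin as Fin using (Fin; zero)
open import Data.Fin.Properties using (injective⇒≤)
open import Data.Product using (∃; _×_; _,_; proj₁; proj₂)
open import Data.Sum using (inj₁; inj₂)
open import Data.List using (List; []; _∷_; filter; allFin; lookup)
open import Data.List.Properties using (length-removeAt′; length-tabulate)
open import Data.List.Relation.Unary.Any using (here; there; index; _─_)
open import Data.List.Relation.Unary.Any.Properties using (lookup-index)
open import Data.List.Relation.Unary.All as All using (All; []; _∷_)
open import Data.List.Relation.Unary.All.Properties using (tabulate⁺; filter⁺; all-filter)
open import Data.List.Relation.Unary.AllPairs using ([]; _∷_)
open import Data.List.Relation.Unary.Unique.Propositional using (Unique)
open import Data.List.Relation.Unary.Unique.Propositional.Properties as Unique using (allFin⁺)
open import Data.List.Membership.Propositional using (_∈_)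
open import Data.List.Membership.Propositional.Properties using (∈-filter⁺)
open import Relation.Binary.PropositionalEquality
open import Relation.Nullary using (¬_; yes; no; ¬?; contradiction)
open import Relation.Nullary.Decidable using (decidable-stable)
open import Function using (_∘_; case_of_)
import Data.Rational as ℚ
import Data.Rational.Properties as ℚ

module _ {A : Set} where

  ∈-─⁺ : ∀ {x y} {ys : List A} (x∈ys : x ∈ ys) → y ∈ ys → y ≢ x → y ∈ (ys ─ x∈ys)
  ∈-─⁺ (here refl) (here refl) y≢x = contradiction refl y≢x
  ∈-─⁺ (here refl) (there y∈ys) _  = y∈ys
  ∈-─⁺ (there _)   (here refl)  _  = here refl
  ∈-─⁺ (there x∈ys) (there y∈ys) y≢x = there (∈-─⁺ x∈ys y∈ys y≢x)

  unique-⊆⇒length≤ : ∀ {xs ys : List A} → Unique xs → All (_∈ ys) xs → length xs ≤ length ys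
  unique-⊆⇒length≤ {[]}          _             _               = z≤n
  unique-⊆⇒length≤ {x ∷ xs} {ys} (x∉xs ∷ !xs) (x∈ys ∷ xs⊆ys) = begin
    suc (length xs)          ≤⟨ s≤s (unique-⊆⇒length≤ !xs xs⊆ys─x) ⟩
    suc (length (ys ─ x∈ys)) ≡⟨ length-removeAt′ ys (index x∈ys) ⟨
    length ys                ∎
    where
    open ≤-Reasoning
    xs⊆ys─x : All (_∈ (ys ─ x∈ys)) xs
    xs⊆ys─x = All.zipWith (λ (x≢z , z∈ys) → ∈-─⁺ x∈ys z∈ys (≢-sym x≢z)) (x∉xs , xs⊆ys)

  unique-allEqual⇒length≤1 : ∀ (xs : List A) → Unique xs →
                             (∀ {x y} → x ∈ xs → y ∈ xs → x ≡ y) → length xs ≤ 1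
  unique-allEqual⇒length≤1 []           _                 _   = z≤n
  unique-allEqual⇒length≤1 (_ ∷ [])     _                 _   = s≤s z≤n
  unique-allEqual⇒length≤1 (_ ∷ _ ∷ _) ((x≢y ∷ _) ∷ _) eq = contradiction (eq (here refl) (there (here refl))) x≢y

module _ {n : ℕ} {A : Set} (f : Fin n → A) where

  walk-resp : ∀ {F : EdgeSet n} → (∀ {a b} → (a , b) ∈ F → f a ≡ f b) →
              ∀ {u v} → Walk F u v → f u ≡ f v
  walk-resp f-edge []         = refl
  walk-resp f-edge (ab ∷ bv) = trans (f-edge ab) (walk-resp f-edge bv)

  uwalk-resp : ∀ {E : EdgeSet n} → (∀ {a b} → (a , b) ∈ E → f a ≡ f b) →
               ∀ {u v} → UWalk E u v → f u ≡ f v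
  uwalk-resp f-edge []              = refl
  uwalk-resp f-edge (inj₁ ab ∷ bv) = trans (f-edge ab) (uwalk-resp f-edge bv)
  uwalk-resp f-edge (inj₂ ba ∷ bv) = trans (sym (f-edge ba)) (uwalk-resp f-edge bv)

replace : ∀ {n} → Fin n → Fin n → Fin n → Fin n
replace c d y with y Fin.≟ c
... | yes _ = d
... | no  _ = y

replace-old : ∀ {n} (c d : Fin n) → replace c d c ≡ d
replace-old c d with c Fin.≟ c
... | yes _   = refl
... | no  c≢c = contradiction refl c≢c

replace-new : ∀ {n} (c d : Fin n) → replace c d d ≡ d
replace-new c d with d Fin.≟ c
... | yes _ = refl
... | no  _ = refl

replace-other : ∀ {n} (c d y : Fin n) → y ≢ c → replace c d y ≡ y
replace-other c d y y≢c with y Fin.≟ c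
... | yes y≡c = contradiction y≡c y≢c
... | no  _   = refl

record ComponentLabelling (n : ℕ) (F : EdgeSet n) : Set where
  field
    label            : Fin n → Fin n
    label-edge       : ∀ {a b} → (a , b) ∈ F → label a ≡ label b
    classes          : List (Fin n)
    classes-unique   : Unique classes
    classes-realised : All (λ c → ∃ λ x → label x ≡ c) classes
    n≤classes+edges  : n ≤ length classes + length F

componentLabelling : ∀ n (F : EdgeSet n) → ComponentLabelling n F
componentLabelling n [] = record
  { label            = λ x → x
  ; label-edge       = λ ()
  ; classes          = allFin n
  ; classes-unique   = allFin⁺ n
  ; classes-realised = tabulate⁺ (λ x → x , refl)
  ; n≤classes+edges  = ≤-reflexive (sym (trans (+-identityʳ _) (length-tabulate (λ x → x))))
  }
componentLabelling n ((a , b) ∷ F) = record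
  { label            = label′
  ; label-edge       = label′-edge
  ; classes          = classes′
  ; classes-unique   = Unique.filter⁺ _ classes-unique
  ; classes-realised = All.zipWith realised′ (filter⁺ _ classes-realised , all-filter _ classes)
  ; n≤classes+edges  = begin
      n                                           ≤⟨ n≤classes+edges ⟩
      length classes + length F                   ≤⟨ +-monoˡ-≤ (length F) classes≤1+classes′ ⟩
      suc (length classes′) + length F            ≡⟨ +-suc (length classes′) (length F) ⟨
      length classes′ + length ((a , b) ∷ F)      ∎
  }
  where
  open ComponentLabelling (componentLabelling n F)
  open ≤-Reasoning

  label′ : Fin n → Fin n
  label′ x = replace (label b) (label a) (label x)

  label′-edge : ∀ {x y} → (x , y) ∈ ((a , b) ∷ F) → label′ x ≡ label′ y
  label′-edge (here refl) = trans (replace-new (label b) (label a)) (sym (replace-old (label b) (label a)))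
  label′-edge (there xy)  = cong (replace (label b) (label a)) (label-edge xy)

  classes′ : List (Fin n)
  classes′ = filter (λ c → ¬? (c Fin.≟ label b)) classes

  realised′ : ∀ {c} → (∃ λ x → label x ≡ c) × c ≢ label b → ∃ λ x → label′ x ≡ c
  realised′ ((x , refl) , c≢lb) = x , replace-other (label b) (label a) (label x) c≢lb

  classes≤1+classes′ : length classes ≤ suc (length classes′)
  classes≤1+classes′ = unique-⊆⇒length≤ classes-unique
    (All.tabulate λ {c} c∈classes → case c Fin.≟ label b of λ where
      (yes refl) → here refl
      (no c≢lb)  → there (∈-filter⁺ (λ c → ¬? (c Fin.≟ label b)) c∈classes c≢lb))

spanning⇒n∸1≤length : ∀ {n} (E F : EdgeSet n) → UnderlyingConnected E →
                      (∀ {u v} → (u , v) ∈ E → ¬ ¬ Walk F u v) → n ∸ 1 ≤ length F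
spanning⇒n∸1≤length {n} E F connected bridged = ∸-monoˡ-≤ 1 (begin
  n                         ≤⟨ n≤classes+edges ⟩
  length classes + length F ≤⟨ +-monoˡ-≤ (length F) one-class ⟩
  1 + length F              ∎)
  where
  open ComponentLabelling (componentLabelling n F)
  open ≤-Reasoning

  label-E-edge : ∀ {u v} → (u , v) ∈ E → label u ≡ label v
  label-E-edge uv = decidable-stable (label _ Fin.≟ label _)
    (λ label-u≢label-v → bridged uv (label-u≢label-v ∘ walk-resp label label-edge))

  one-class : length classes ≤ 1
  one-class = unique-allEqual⇒length≤1 classes classes-unique λ c∈ d∈ →
    case All.lookup classes-realised c∈ , All.lookup classes-realised d∈ of λ where
      ((x , refl) , (y , refl)) → uwalk-resp label label-E-edge (connected x y)

¬¬-lastHolding : (P : ℕ → Set) → ∀ d {a} → P a → ¬ P (a + d) →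
                 ¬ ¬ ∃ λ k → a ≤ k × P k × ¬ P (suc k)
¬¬-lastHolding P zero    {a} Pa ¬Pa+0   _     = ¬Pa+0 (subst P (sym (+-identityʳ a)) Pa)
¬¬-lastHolding P (suc d) {a} Pa ¬Pa+1+d ¬last = ¬last (a , ≤-refl , Pa , ¬Pa+1)
  where
  ¬Pa+1 : ¬ P (suc a)
  ¬Pa+1 Pa+1 = ¬¬-lastHolding P d Pa+1 (subst (¬_ ∘ P) (+-suc a d) ¬Pa+1+d)
    λ (k , a+1≤k , Pk , ¬Pk+1) → ¬last (k , ≤-trans (n≤1+n a) a+1≤k , Pk , ¬Pk+1)

firstEdge : ∀ {n} {E : EdgeSet n} {u v} (w : Walk E u v) → u ≢ v →
            ∃ λ e → e ∈ E × e ∈ walkEdges w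
firstEdge []       u≢u = contradiction refl u≢u
firstEdge (uv ∷ _) _   = _ , uv , here refl

-- Edge-disjoint paths between distinct vertices have pairwise distinct first edges.
disjointPaths⇒≤length : ∀ {n} {E : EdgeSet n} {u v k} → u ≢ v → DisjointPaths E u v k → k ≤ length E
disjointPaths⇒≤length {E = E} {u} {v} {k} u≢v (P , disjoint) = injective⇒≤ firstIndex-injective
  where
  path : Fin k → Walk E u v
  path i = proj₁ (P i)

  first : (i : Fin k) → ∃ λ e → e ∈ E × e ∈ walkEdges (path i)
  first i = firstEdge (path i) u≢v

  firstIndex : Fin k → Fin (length E)
  firstIndex i = index (proj₁ (proj₂ (first i)))

  first≡lookup : ∀ i → proj₁ (first i) ≡ lookup E (firstIndex i)
  first≡lookup i = lookup-index (proj₁ (proj₂ (first i)))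

  firstIndex-injective : ∀ {i j} → firstIndex i ≡ firstIndex j → i ≡ j
  firstIndex-injective {i} {j} same with i Fin.≟ j
  ... | yes i≡j = i≡j
  ... | no  i≢j = contradiction (first-i∈path-i , first-i∈path-j) (disjoint i j i≢j)
    where
    first-i∈path-i : proj₁ (first i) ∈ walkEdges (path i)
    first-i∈path-i = proj₂ (proj₂ (first i))

    first-i∈path-j : proj₁ (first i) ∈ walkEdges (path j)
    first-i∈path-j = subst (_∈ walkEdges (path j)) first-j≡first-i (proj₂ (proj₂ (first j)))
      where
      first-j≡first-i : proj₁ (first j) ≡ proj₁ (first i)
      first-j≡first-i = begin
        proj₁ (first j)           ≡⟨ first≡lookup j ⟩
        lookup E (firstIndex j)   ≡⟨ cong (lookup E) same ⟨
        lookup E (firstIndex i)   ≡⟨ first≡lookup i ⟨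
        proj₁ (first i)           ∎
        where open ≡-Reasoning

positive*ℕ⁺≰0 : ∀ {α} j → 0ℚ < α → ¬ (α ℚ.* ℕtoℚ (suc j) ℚ.≤ ℕtoℚ 0)
positive*ℕ⁺≰0 {α} j α>0 α*k≤0 = ℚ.<-irrefl refl (ℚ.<-≤-trans (ℚ.positive⁻¹ (α ℚ.* ℕtoℚ (suc j))) α*k≤0)
  where
  instance
    α-pos : ℚ.Positive α
    α-pos = ℚ.positive α>0
    k-pos : ℚ.Positive (ℕtoℚ (suc j))
    k-pos = ℚ.normalize-pos (suc j) 1
    α*k-pos : ℚ.Positive (α ℚ.* ℕtoℚ (suc j))
    α*k-pos = ℚ.pos*pos⇒pos α (ℕtoℚ (suc j))

¬walk⇒IsLambda0 : ∀ {n} {F : EdgeSet n} {u v} → ¬ Walk F u v → IsLambda F u v 0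
¬walk⇒IsLambda0 ¬walk = ((λ ()) , λ ()) , λ (P , _) → ¬walk (proj₁ (P zero))

-- DisjointPaths is not decidable, so λ_G(u,v) exists only under double negation; that suffices,
-- since the labels compared in spanning⇒n∸1≤length have decidable equality.
edge⇒¬¬IsLambda≥1 : ∀ {n} {E : EdgeSet n} {u v} → u ≢ v → (u , v) ∈ E →
                     ¬ ¬ ∃ λ k → 1 ≤ k × IsLambda E u v k
edge⇒¬¬IsLambda≥1 {E = E} {u} {v} u≢v uv ¬λ =
  ¬¬-lastHolding (DisjointPaths E u v) (length E) one-path too-many-paths ¬λ
  where
  one-path : DisjointPaths E u v 1
  one-path = (λ _ → uv ∷ [] , (u≢v ∷ []) ∷ [] ∷ []) , λ { zero zero 0≢0 → contradiction refl 0≢0 }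

  too-many-paths : ¬ DisjointPaths E u v (1 + length E)
  too-many-paths paths = <-irrefl refl (disjointPaths⇒≤length u≢v paths)

feasible⇒¬¬walk : ∀ {n} {E F : EdgeSet n} {α} → SimpleDigraph n E → 0ℚ < α → Feasible E α F →
                  ∀ {u v} → (u , v) ∈ E → ¬ ¬ Walk F u v
feasible⇒¬¬walk simple α>0 (_ , retains) {u} {v} uv ¬walk =
  edge⇒¬¬IsLambda≥1 u≢v uv λ where
    (suc k , _ , λ-E) → positive*ℕ⁺≰0 k α>0 (retains _ _ u≢v (suc k) 0 λ-E (¬walk⇒IsLambda0 ¬walk))
  where
  u≢v : u ≢ v
  u≢v = All.lookup (SimpleDigraph.noLoops simple) uv

-- The bound |F| ≥ n - 1 holds for every feasible F.
mainTheorem2 : (n : ℕ) (E : EdgeSet n) → SimpleDigraph n E → UnderlyingConnected E →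
    (α : ℚ) → 0ℚ < α → α < 1ℚ →
    (E' F : EdgeSet n) → Feasible E α E' → Optimal E α F →
    length E' * (n ∸ 1) ≤ length E * length F
mainTheorem2 n E simple connected α α>0 _ E' F ((E'-unique , E'⊆E) , _) (F-feasible , _) =
  *-mono-≤ (unique-⊆⇒length≤ E'-unique E'⊆E)
           (spanning⇒n∸1≤length E F connected (feasible⇒¬¬walk simple α>0 F-feasible))
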